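{- Let $\mathbf{U}=(\mathbf{T},G,H)$ be a tense centered KI-algebra. Then the map $\beta_{\mathbf{U}}:T\to K(C(T))$, $\beta_{\mathbf{U}}(x)=(x\vee c,\sim x\vee c)$, is an injective homomorphism of tense centered KI-algebras from $\mathbf{U}$ into $\mathrm{K}(\mathrm{C}(\mathbf{U}))$.
   Context: A centered Kleene algebra is $\langle T,\wedge,\vee,\sim,c,0,1\rangle$ with bounded distributive lattice reduct, $\sim\sim x=x$, $\sim(x\vee y)=\sim x\wedge\sim y$, $x\wedge\sim x\le y\vee\sim y$, $\sim c=c$. A KI-algebra is $\langle T,\wedge,\vee,\Rightarrow,\sim,c,0,1\rangle$ with centered Kleene reduct such that: $(a\Rightarrow b)\wedge(a\Rightarrow d)=a\Rightarrow(b\wedge d)$, $(a\Rightarrow d)\wedge(b\Rightarrow d)=(a\vee b)\Rightarrow d$, $0\Rightarrow a=1$, $a\Rightarrow 1=1$; $(x\wedge(x\Rightarrow y))\vee c\le y\vee c$; $c\Rightarrow c=1$; $(x\Rightarrow y)\wedge c=(\sim x\vee y)\wedge c$; $(x\Rightarrow\sim y)\vee c=(x\Rightarrow(\sim y\vee c))\wedge(y\Rightarrow(\sim x\vee c))$. A tense centered KI-algebra is $(\mathbf{T},G,H)$ with $F(x):=\sim G(\sim x)$, $P(x):=\sim H(\sim x)$, satisfying $G(1)=H(1)=1$; $G,H$ preserve $\wedge$; $x\le GP(x)$, $x\le HF(x)$; $G(x\vee y)\le G(x)\vee F(y)$, $H(x\vee y)\le H(x)\vee P(y)$; $G(x\Rightarrow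 y)\le G(x)\Rightarrow G(y)$, $H(x\Rightarrow y)\le H(x)\Rightarrow H(y)$; $G(x\Rightarrow y)\le F(x)\Rightarrow F(y)$, $H(x\Rightarrow y)\le P(x)\Rightarrow P(y)$; $G(c)=c=H(c)$. $\mathrm{C}(\mathbf{U})$ is $C(T)=\{x\in T:x\ge c\}$ with $\wedge,\vee,\Rightarrow,G,H,F,P$ restricted, bottom $c$ and top $1$. For such an algebra $\mathbf{B}=(B,\wedge,\vee,\Rightarrow,0_B,1,G,H,F,P)$ with bottom $0_B$, $\mathrm{K}(\mathbf{B})$ is $K(B)=\{(a,b)\in B^2:a\wedge b=0_B\}$ with $(a,b)\vee(x,y)=(a\vee x,b\wedge y)$, $(a,b)\wedge(x,y)=(a\wedge x,b\vee y)$, $(a,b)\Rightarrow(x,y)=((a\Rightarrow x)\wedge(y\Rightarrow b),a\wedge y)$, $\sim(a,b)=(b,a)$, bottom $(0_B,1)$, top $(1,0_B)$, center $(0_B,0_B)$, $G_K(a,b)=(G(a),F(b))$, $H_K(a,b)=(H(a),P(b))$. -}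

module Defs where

open import Level using (Level; suc)
open import Data.Product using (_×_; _,_; proj₁; proj₂)
open import Relation.Binary.PropositionalEquality using (_≡_)
open import Algebra.Lattice.Structures using (IsDistributiveLattice)

record TenseCenteredKI (ℓ : Level) : Set (suc ℓ) where
  infixr 6 _∨_
  infixr 7 _∧_
  infixr 5 _⇒_
  field
    Carrier : Set ℓ
    _∧_ _∨_ _⇒_ : Carrier → Carrier → Carrier
    ∼ : Carrier → Carrier
    c 𝟘 𝟙 : Carrier
    G H : Carrier → Carrier

  _≤_ : Carrier → Carrier → Set ℓ
  x ≤ y = x ∧ y ≡ x

  F : Carrier → Carrier
  F x = ∼ (G (∼ x))

  P : Carrier → Carrier
  P x = ∼ (H (∼ x))

  field
    isDistributiveLattice : IsDistributiveLattice _≡_ _∨_ _∧_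
    𝟘-bottom : ∀ x → 𝟘 ∧ x ≡ 𝟘
    𝟙-top    : ∀ x → x ∧ 𝟙 ≡ x
    ∼-invol    : ∀ x → ∼ (∼ x) ≡ x
    ∼-deMorgan : ∀ x y → ∼ (x ∨ y) ≡ ∼ x ∧ ∼ y
    kleene     : ∀ x y → (x ∧ ∼ x) ≤ (y ∨ ∼ y)
    ∼c         : ∼ c ≡ c
    ⇒-∧ʳ : ∀ a b d → (a ⇒ b) ∧ (a ⇒ d) ≡ a ⇒ (b ∧ d)
    ⇒-∨ˡ : ∀ a b d → (a ⇒ d) ∧ (b ⇒ d) ≡ (a ∨ b) ⇒ d
    𝟘⇒   : ∀ a → 𝟘 ⇒ a ≡ 𝟙
    ⇒𝟙   : ∀ a → a ⇒ 𝟙 ≡ 𝟙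
    mp   : ∀ x y → ((x ∧ (x ⇒ y)) ∨ c) ≤ (y ∨ c)
    c⇒c  : c ⇒ c ≡ 𝟙
    ⇒-c  : ∀ x y → (x ⇒ y) ∧ c ≡ (∼ x ∨ y) ∧ c
    ⇒-∼  : ∀ x y → (x ⇒ ∼ y) ∨ c ≡ (x ⇒ (∼ y ∨ c)) ∧ (y ⇒ (∼ x ∨ c))
    G𝟙 : G 𝟙 ≡ 𝟙
    H𝟙 : H 𝟙 ≡ 𝟙
    G-∧ : ∀ x y → G (x ∧ y) ≡ G x ∧ G y
    H-∧ : ∀ x y → H (x ∧ y) ≡ H x ∧ H y
    x≤GP : ∀ x → x ≤ G (P x)
    x≤HF : ∀ x → x ≤ H (F x)
    G-∨ : ∀ x y → G (x ∨ y) ≤ (G x ∨ F y)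
    H-∨ : ∀ x y → H (x ∨ y) ≤ (H x ∨ P y)
    G-⇒ : ∀ x y → G (x ⇒ y) ≤ (G x ⇒ G y)
    H-⇒ : ∀ x y → H (x ⇒ y) ≤ (H x ⇒ H y)
    G-⇒F : ∀ x y → G (x ⇒ y) ≤ (F x ⇒ F y)
    H-⇒P : ∀ x y → H (x ⇒ y) ≤ (P x ⇒ P y)
    Gc : G c ≡ c
    Hc : H c ≡ c

  -- C(U): the elements above c (bottom c, top 𝟙, operations restricted).
  InC : Carrier → Set ℓ
  InC x = c ≤ x

  -- K(C(U)): pairs (a , b) of elements of C(T) with a ∧ b = c (the bottom of C).
  InKC : Carrier × Carrier → Set ℓ
  InKC (a , b) = InC a × InC b × (a ∧ b ≡ c)

  -- Operations of K(C(U)), written on the underlying pairs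
  -- (bottom of C(U) is c; G, H, F, P of C(U) are restrictions of those of U).
  _∨K_ : Carrier × Carrier → Carrier × Carrier → Carrier × Carrier
  (a , b) ∨K (x , y) = (a ∨ x , b ∧ y)

  _∧K_ : Carrier × Carrier → Carrier × Carrier → Carrier × Carrier
  (a , b) ∧K (x , y) = (a ∧ x , b ∨ y)

  _⇒K_ : Carrier × Carrier → Carrier × Carrier → Carrier × Carrier
  (a , b) ⇒K (x , y) = ((a ⇒ x) ∧ (y ⇒ b) , a ∧ y)

  ∼K : Carrier × Carrier → Carrier × Carrier
  ∼K (a , b) = (b , a)

  𝟘K 𝟙K cK : Carrier × Carrier
  𝟘K = (c , 𝟙)
  𝟙K = (𝟙 , c)
  cK = (c , c)

  GK HK : Carrier × Carrier → Carrier × Carrier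
  GK (a , b) = (G a , F b)
  HK (a , b) = (H a , P b)

  β : Carrier → Carrier × Carrier
  β x = (x ∨ c , ∼ x ∨ c)

  IsInjectiveTenseKIHomInto-KC : Set ℓ
  IsInjectiveTenseKIHomInto-KC =
      (∀ x → InKC (β x))
    × (∀ x y → β (x ∧ y) ≡ β x ∧K β y)
    × (∀ x y → β (x ∨ y) ≡ β x ∨K β y)
    × (∀ x y → β (x ⇒ y) ≡ β x ⇒K β y)
    × (∀ x → β (∼ x) ≡ ∼K (β x))
    × (β c ≡ cK)
    × (β 𝟘 ≡ 𝟘K)
    × (β 𝟙 ≡ 𝟙K)
    × (∀ x → β (G x) ≡ GK (β x))
    × (∀ x → β (H x) ≡ HK (β x))
    × (∀ x y → β x ≡ β y → x ≡ y)

-- The map x ↦ x ∨ c is a lattice homomorphism onto the filter above c, and the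
-- second coordinate of β x is ∼ x ∨ c = ∼ (x ∧ c); since ∼ exchanges ∨ and ∧, β
-- respects the lattice operations and ∼.  The axiom for (x ⇒ ∼ y) ∨ c yields the
-- first coordinate of β (x ⇒ y), using c ⇒ (y ∨ c) = 𝟙, and the axiom for
-- (x ⇒ y) ∧ c yields the second.  An operator that preserves ∧, fixes c and satisfies
-- G (x ∨ y) ≤ G x ∨ F y commutes with _∨ c and _∧ c, which handles G and H.  Finally
-- x ∨ c and ∼ (∼ x ∨ c) = x ∧ c determine x in a distributive lattice.
module Submission where

open import Defs
open import Level using (Level)
open import Data.Product using (_,_; proj₁; proj₂)
open import Relation.Binary.PropositionalEquality
open import Algebra.Bundles using (CommutativeSemigroup)
open import Algebra.Lattice.Bundles using (DistributiveLattice)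
open import Algebra.Lattice.Structures using (IsDistributiveLattice)
import Algebra.Lattice.Properties.DistributiveLattice as DistributiveLatticeProperties
import Algebra.Properties.CommutativeSemigroup as CommutativeSemigroupProperties

module Properties {ℓ : Level} (U : TenseCenteredKI ℓ) where
  open TenseCenteredKI U
  open IsDistributiveLattice isDistributiveLattice
    using ( ∨-comm; ∧-comm; ∨-absorbs-∧; ∧-absorbs-∨
          ; ∨-distribʳ-∧; ∧-distribʳ-∨; ∧-distribˡ-∨ )
  open ≡-Reasoning

  distributiveLattice : DistributiveLattice ℓ ℓ
  distributiveLattice = record { isDistributiveLattice = isDistributiveLattice }

  open DistributiveLatticeProperties distributiveLattice
    using (∨-idem; ∨-isSemigroup)

  ∨-commutativeSemigroup : CommutativeSemigroup ℓ ℓ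
  ∨-commutativeSemigroup = record
    { isCommutativeSemigroup = record { isSemigroup = ∨-isSemigroup ; comm = ∨-comm } }

  open CommutativeSemigroupProperties ∨-commutativeSemigroup
    using () renaming (interchange to ∨-interchange)

  ≤-antisym : ∀ {x y} → x ≤ y → y ≤ x → x ≡ y
  ≤-antisym {x} {y} x≤y y≤x = trans (sym x≤y) (trans (∧-comm x y) y≤x)

  x≤x∨y : ∀ x y → x ≤ (x ∨ y)
  x≤x∨y = ∧-absorbs-∨

  y≤x∨y : ∀ x y → y ≤ (x ∨ y)
  y≤x∨y x y = trans (cong (y ∧_) (∨-comm x y)) (∧-absorbs-∨ y x)

  ∨-least : ∀ {x y z} → x ≤ z → y ≤ z → (x ∨ y) ≤ z
  ∨-least {x} {y} {z} x≤z y≤z = trans (∧-distribʳ-∨ z x y) (cong₂ _∨_ x≤z y≤z)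

  x≤y⇒x∨y≡y : ∀ {x y} → x ≤ y → x ∨ y ≡ y
  x≤y⇒x∨y≡y {x} {y} x≤y = begin
    x ∨ y        ≡⟨ cong (_∨ y) (sym x≤y) ⟩
    (x ∧ y) ∨ y  ≡⟨ ∨-comm (x ∧ y) y ⟩
    y ∨ (x ∧ y)  ≡⟨ cong (y ∨_) (∧-comm x y) ⟩
    y ∨ (y ∧ x)  ≡⟨ ∨-absorbs-∧ y x ⟩
    y            ∎

  ∨-identityˡ : ∀ x → 𝟘 ∨ x ≡ x
  ∨-identityˡ x = x≤y⇒x∨y≡y (𝟘-bottom x)

  ∨-zeroˡ : ∀ x → 𝟙 ∨ x ≡ 𝟙
  ∨-zeroˡ x = trans (∨-comm 𝟙 x) (x≤y⇒x∨y≡y (𝟙-top x))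

  ∨-distribʳ-∨ : ∀ x y z → (x ∨ y) ∨ z ≡ (x ∨ z) ∨ (y ∨ z)
  ∨-distribʳ-∨ x y z = trans (cong ((x ∨ y) ∨_) (sym (∨-idem z))) (∨-interchange x y z z)

  ∨-∧-cancel : ∀ {x y z} → x ∨ z ≡ y ∨ z → x ∧ z ≡ y ∧ z → x ≡ y
  ∨-∧-cancel {x} {y} {z} ∨-eq ∧-eq = begin
    x                  ≡⟨ sym (∧-absorbs-∨ x z) ⟩
    x ∧ (x ∨ z)        ≡⟨ cong (x ∧_) ∨-eq ⟩
    x ∧ (y ∨ z)        ≡⟨ ∧-distribˡ-∨ x y z ⟩
    (x ∧ y) ∨ (x ∧ z)  ≡⟨ cong₂ _∨_ (∧-comm x y) ∧-eq ⟩
    (y ∧ x) ∨ (y ∧ z)  ≡⟨ sym (∧-distribˡ-∨ y x z) ⟩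
    y ∧ (x ∨ z)        ≡⟨ cong (y ∧_) ∨-eq ⟩
    y ∧ (y ∨ z)        ≡⟨ ∧-absorbs-∨ y z ⟩
    y                  ∎

  ∼-deMorgan-∧ : ∀ x y → ∼ (x ∧ y) ≡ ∼ x ∨ ∼ y
  ∼-deMorgan-∧ x y = begin
    ∼ (x ∧ y)              ≡⟨ cong ∼ (cong₂ _∧_ (sym (∼-invol x)) (sym (∼-invol y))) ⟩
    ∼ (∼ (∼ x) ∧ ∼ (∼ y))  ≡⟨ cong ∼ (sym (∼-deMorgan (∼ x) (∼ y))) ⟩
    ∼ (∼ (∼ x ∨ ∼ y))      ≡⟨ ∼-invol (∼ x ∨ ∼ y) ⟩
    ∼ x ∨ ∼ y              ∎

  ∼𝟘 : ∼ 𝟘 ≡ 𝟙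
  ∼𝟘 = begin
    ∼ 𝟘              ≡⟨ sym (𝟙-top (∼ 𝟘)) ⟩
    ∼ 𝟘 ∧ 𝟙          ≡⟨ cong (∼ 𝟘 ∧_) (sym (∼-invol 𝟙)) ⟩
    ∼ 𝟘 ∧ ∼ (∼ 𝟙)    ≡⟨ sym (∼-deMorgan 𝟘 (∼ 𝟙)) ⟩
    ∼ (𝟘 ∨ ∼ 𝟙)      ≡⟨ cong ∼ (∨-identityˡ (∼ 𝟙)) ⟩
    ∼ (∼ 𝟙)          ≡⟨ ∼-invol 𝟙 ⟩
    𝟙                ∎

  ∼𝟙 : ∼ 𝟙 ≡ 𝟘
  ∼𝟙 = trans (cong ∼ (sym ∼𝟘)) (∼-invol 𝟘)

  x∧∼x≤c : ∀ x → (x ∧ ∼ x) ≤ c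
  x∧∼x≤c x = subst ((x ∧ ∼ x) ≤_) (trans (cong (c ∨_) ∼c) (∨-idem c)) (kleene x c)

  ∼x∨c≡∼[x∧c] : ∀ x → ∼ x ∨ c ≡ ∼ (x ∧ c)
  ∼x∨c≡∼[x∧c] x = trans (cong (∼ x ∨_) (sym ∼c)) (sym (∼-deMorgan-∧ x c))

  ∼[∼x∨c]≡x∧c : ∀ x → ∼ (∼ x ∨ c) ≡ x ∧ c
  ∼[∼x∨c]≡x∧c x = trans (cong ∼ (∼x∨c≡∼[x∧c] x)) (∼-invol (x ∧ c))

  ⇒-monoʳ-≤ : ∀ {a x y} → x ≤ y → (a ⇒ x) ≤ (a ⇒ y)
  ⇒-monoʳ-≤ {a} {x} {y} x≤y = trans (⇒-∧ʳ a x y) (cong (a ⇒_) x≤y)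

  c⇒x∨c≡𝟙 : ∀ x → c ⇒ (x ∨ c) ≡ 𝟙
  c⇒x∨c≡𝟙 x = ≤-antisym (𝟙-top _) (subst (_≤ (c ⇒ (x ∨ c))) c⇒c (⇒-monoʳ-≤ (y≤x∨y x c)))

  x∨c⇒y∨c≡x⇒y∨c : ∀ x y → (x ∨ c) ⇒ (y ∨ c) ≡ x ⇒ (y ∨ c)
  x∨c⇒y∨c≡x⇒y∨c x y = begin
    (x ∨ c) ⇒ (y ∨ c)              ≡⟨ sym (⇒-∨ˡ x c (y ∨ c)) ⟩
    (x ⇒ (y ∨ c)) ∧ (c ⇒ (y ∨ c))  ≡⟨ cong ((x ⇒ (y ∨ c)) ∧_) (c⇒x∨c≡𝟙 y) ⟩
    (x ⇒ (y ∨ c)) ∧ 𝟙              ≡⟨ 𝟙-top (x ⇒ (y ∨ c)) ⟩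
    x ⇒ (y ∨ c)                    ∎

  β-InKC : ∀ x → InKC (β x)
  β-InKC x = y≤x∨y x c , y≤x∨y (∼ x) c , (begin
    (x ∨ c) ∧ (∼ x ∨ c)  ≡⟨ sym (∨-distribʳ-∧ c x (∼ x)) ⟩
    (x ∧ ∼ x) ∨ c        ≡⟨ x≤y⇒x∨y≡y (x∧∼x≤c x) ⟩
    c                    ∎)

  β-∧ : ∀ x y → β (x ∧ y) ≡ β x ∧K β y
  β-∧ x y = cong₂ _,_ (∨-distribʳ-∧ c x y) (begin
    ∼ (x ∧ y) ∨ c    ≡⟨ cong (_∨ c) (∼-deMorgan-∧ x y) ⟩
    (∼ x ∨ ∼ y) ∨ c  ≡⟨ ∨-distribʳ-∨ (∼ x) (∼ y) c ⟩
    (∼ x ∨ c) ∨ (∼ y ∨ c) ∎)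

  β-∨ : ∀ x y → β (x ∨ y) ≡ β x ∨K β y
  β-∨ x y = cong₂ _,_ (∨-distribʳ-∨ x y c) (begin
    ∼ (x ∨ y) ∨ c    ≡⟨ cong (_∨ c) (∼-deMorgan x y) ⟩
    (∼ x ∧ ∼ y) ∨ c  ≡⟨ ∨-distribʳ-∧ c (∼ x) (∼ y) ⟩
    (∼ x ∨ c) ∧ (∼ y ∨ c) ∎)

  β-⇒ : ∀ x y → β (x ⇒ y) ≡ β x ⇒K β y
  β-⇒ x y = cong₂ _,_ (begin
    (x ⇒ y) ∨ c                                    ≡⟨ cong (λ t → (x ⇒ t) ∨ c) (sym (∼-invol y)) ⟩
    (x ⇒ ∼ (∼ y)) ∨ c                              ≡⟨ ⇒-∼ x (∼ y) ⟩
    (x ⇒ (∼ (∼ y) ∨ c)) ∧ (∼ y ⇒ (∼ x ∨ c))        ≡⟨ cong (λ t → (x ⇒ (t ∨ c)) ∧ (∼ y ⇒ (∼ x ∨ c))) (∼-invol y) ⟩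
    (x ⇒ (y ∨ c)) ∧ (∼ y ⇒ (∼ x ∨ c))              ≡⟨ sym (cong₂ _∧_ (x∨c⇒y∨c≡x⇒y∨c x y) (x∨c⇒y∨c≡x⇒y∨c (∼ y) (∼ x))) ⟩
    ((x ∨ c) ⇒ (y ∨ c)) ∧ ((∼ y ∨ c) ⇒ (∼ x ∨ c))  ∎)
    (begin
    ∼ (x ⇒ y) ∨ c          ≡⟨ ∼x∨c≡∼[x∧c] (x ⇒ y) ⟩
    ∼ ((x ⇒ y) ∧ c)        ≡⟨ cong ∼ (⇒-c x y) ⟩
    ∼ ((∼ x ∨ y) ∧ c)      ≡⟨ sym (∼x∨c≡∼[x∧c] (∼ x ∨ y)) ⟩
    ∼ (∼ x ∨ y) ∨ c        ≡⟨ cong (_∨ c) (∼-deMorgan (∼ x) y) ⟩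
    (∼ (∼ x) ∧ ∼ y) ∨ c    ≡⟨ cong (λ t → (t ∧ ∼ y) ∨ c) (∼-invol x) ⟩
    (x ∧ ∼ y) ∨ c          ≡⟨ ∨-distribʳ-∧ c x (∼ y) ⟩
    (x ∨ c) ∧ (∼ y ∨ c)    ∎)

  β-∼ : ∀ x → β (∼ x) ≡ ∼K (β x)
  β-∼ x = cong (λ t → (∼ x ∨ c , t ∨ c)) (∼-invol x)

  β-c : β c ≡ cK
  β-c = cong₂ _,_ (∨-idem c) (trans (cong (_∨ c) ∼c) (∨-idem c))

  β-𝟘 : β 𝟘 ≡ 𝟘K
  β-𝟘 = cong₂ _,_ (∨-identityˡ c) (trans (cong (_∨ c) ∼𝟘) (∨-zeroˡ c))

  β-𝟙 : β 𝟙 ≡ 𝟙K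
  β-𝟙 = cong₂ _,_ (∨-zeroˡ c) (trans (cong (_∨ c) ∼𝟙) (∨-identityˡ c))

  β-injective : ∀ x y → β x ≡ β y → x ≡ y
  β-injective x y βx≡βy = ∨-∧-cancel (cong proj₁ βx≡βy) (begin
    x ∧ c            ≡⟨ sym (∼[∼x∨c]≡x∧c x) ⟩
    ∼ (∼ x ∨ c)      ≡⟨ cong (λ βx → ∼ (proj₂ βx)) βx≡βy ⟩
    ∼ (∼ y ∨ c)      ≡⟨ ∼[∼x∨c]≡x∧c y ⟩
    y ∧ c            ∎)

  -- T stands for G or H; the dual ∼ T (∼ y) is then F y or P y.
  module TenseOperator
    (T : Carrier → Carrier)
    (T-∧ : ∀ x y → T (x ∧ y) ≡ T x ∧ T y)
    (T-∨ : ∀ x y → T (x ∨ y) ≤ (T x ∨ ∼ (T (∼ y))))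
    (Tc : T c ≡ c)
    where

    T-mono : ∀ {x y} → x ≤ y → T x ≤ T y
    T-mono {x} {y} x≤y = trans (sym (T-∧ x y)) (cong T x≤y)

    ∼T∼c≡c : ∼ (T (∼ c)) ≡ c
    ∼T∼c≡c = trans (cong (λ t → ∼ (T t)) ∼c) (trans (cong ∼ Tc) ∼c)

    T-∨c : ∀ x → T (x ∨ c) ≡ T x ∨ c
    T-∨c x = ≤-antisym
      (subst (λ t → T (x ∨ c) ≤ (T x ∨ t)) ∼T∼c≡c (T-∨ x c))
      (∨-least (T-mono (x≤x∨y x c)) (subst (_≤ T (x ∨ c)) Tc (T-mono (y≤x∨y x c))))

    β-T : ∀ x → β (T x) ≡ (T (x ∨ c) , ∼ (T (∼ (∼ x ∨ c))))
    β-T x = cong₂ _,_ (sym (T-∨c x)) (begin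
      ∼ (T x) ∨ c            ≡⟨ ∼x∨c≡∼[x∧c] (T x) ⟩
      ∼ (T x ∧ c)            ≡⟨ cong (λ t → ∼ (T x ∧ t)) (sym Tc) ⟩
      ∼ (T x ∧ T c)          ≡⟨ cong ∼ (sym (T-∧ x c)) ⟩
      ∼ (T (x ∧ c))          ≡⟨ cong (λ t → ∼ (T t)) (sym (∼[∼x∨c]≡x∧c x)) ⟩
      ∼ (T (∼ (∼ x ∨ c)))    ∎)

  β-G : ∀ x → β (G x) ≡ GK (β x)
  β-G = TenseOperator.β-T G G-∧ G-∨ Gc

  β-H : ∀ x → β (H x) ≡ HK (β x)
  β-H = TenseOperator.β-T H H-∧ H-∨ Hc

lemma5p6 : ∀ {ℓ : Level} (U : TenseCenteredKI ℓ) → TenseCenteredKI.IsInjectiveTenseKIHomInto-KC U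
lemma5p6 U =
  β-InKC , β-∧ , β-∨ , β-⇒ , β-∼ , β-c , β-𝟘 , β-𝟙 , β-G , β-H , β-injective
  where open Properties U
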